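{- Let $G'$ be a subcubic graph with no isolated vertex, let $v'$ be a vertex of degree at most $2$ in $G'$, and let $G$ be the (subcubic) graph obtained from $G'$ by adding a vertex-disjoint copy of $K_{2,3}$ and adding an edge joining $v'$ to a vertex of degree $2$ in the added copy of $K_{2,3}$. Then (a) $i(G) = i(G') + 2$, and (b) $\mathrm{w}(G) = \mathrm{w}(G') + 16$.
   Context: $i(H)$ denotes the independent domination number of a graph $H$: the minimum size of an independent set $S\subseteq V(H)$ such that every vertex outside $S$ has a neighbor in $S$. For a subcubic graph $H$, the vertex weight is $\mathrm{w}(H) = 8n_0(H)+5n_1(H)+4n_2(H)+3n_3(H)$, where $n_j(H)$ is the number of vertices of degree $j$ in $H$. -}

module Defs where

open import Data.Nat using (ℕ; zero; suc; _+_; _≤_; _<ᵇ_)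
open import Data.Bool using (Bool; true; false; if_then_else_; _∧_; _∨_; not)
open import Data.Fin using (Fin; splitAt; _↑ʳ_; toℕ; _≟_)
open import Data.Fin.Subset using (Subset; _∈_; _∉_; ∣_∣)
open import Data.List using (List; map; allFin)
open import Data.Nat.ListAction using (sum)
open import Data.Sum using (_⊎_; inj₁; inj₂)
open import Data.Product using (Σ; ∃; _×_; _,_)
open import Relation.Binary.PropositionalEquality using (_≡_)
open import Relation.Nullary.Decidable using (⌊_⌋)

Adj : ℕ → Set
Adj n = Fin n → Fin n → Bool

IsSimple : ∀ {n} → Adj n → Set
IsSimple {n} A = (∀ x y → A x y ≡ A y x) × (∀ x → A x x ≡ false)

b2n : Bool → ℕ
b2n true = 1
b2n false = 0

deg : ∀ {n} → Adj n → Fin n → ℕ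
deg {n} A x = sum (map (λ y → b2n (A x y)) (allFin n))

Subcubic : ∀ {n} → Adj n → Set
Subcubic {n} A = ∀ x → deg A x ≤ 3

NoIsolated : ∀ {n} → Adj n → Set
NoIsolated {n} A = ∀ x → 1 ≤ deg A x

-- vertex weight contribution: 8, 5, 4, 3 for degrees 0, 1, 2, 3
-- (only applied to subcubic graphs, where degree ≥ 3 means degree 3)
wdeg : ℕ → ℕ
wdeg 0 = 8
wdeg 1 = 5
wdeg 2 = 4
wdeg _ = 3

weight : ∀ {n} → Adj n → ℕ
weight {n} A = sum (map (λ x → wdeg (deg A x)) (allFin n))

Independent : ∀ {n} → Adj n → Subset n → Set
Independent {n} A S = ∀ x y → x ∈ S → y ∈ S → A x y ≡ false

Dominating : ∀ {n} → Adj n → Subset n → Set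
Dominating {n} A S = ∀ x → x ∉ S → ∃ λ y → y ∈ S × A x y ≡ true

IndependentDominating : ∀ {n} → Adj n → Subset n → Set
IndependentDominating A S = Independent A S × Dominating A S

IsIndDomNum : ∀ {n} → Adj n → ℕ → Set
IsIndDomNum {n} A k =
  (∃ λ S → IndependentDominating A S × ∣ S ∣ ≡ k)
  × (∀ S → IndependentDominating A S → k ≤ ∣ S ∣)

-- K_{2,3} on Fin 5: parts {0,1} and {2,3,4}
K23 : Adj 5
K23 p q = (toℕ p <ᵇ 2) ∧ not (toℕ q <ᵇ 2) ∨ (toℕ q <ᵇ 2) ∧ not (toℕ p <ᵇ 2)

-- G' on Fin n plus a disjoint K_{2,3} (vertices n, …, n+4), with an edge
-- joining v' to the degree-2 vertex (2 + j) of K_{2,3}.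
attachK23 : ∀ {n} → Adj n → Fin n → Fin 3 → Adj (n + 5)
attachK23 {n} A v j x y with splitAt n x | splitAt n y
... | inj₁ u | inj₁ u' = A u u'
... | inj₂ p | inj₂ q = K23 p q
... | inj₁ u | inj₂ q = ⌊ u ≟ v ⌋ ∧ ⌊ q ≟ 2 ↑ʳ j ⌋
... | inj₂ p | inj₁ u = ⌊ u ≟ v ⌋ ∧ ⌊ p ≟ 2 ↑ʳ j ⌋

-- A minimum independent dominating set of G' together with the two degree-3
-- vertices of the K₂,₃ independently dominates G.  Conversely, an independent
-- dominating set of G meets the K₂,₃ in at least two vertices, and in at least
-- three if it contains the vertex x₀ joined to v; only in that case can its trace
-- on G' fail to dominate G', and then only at v, so adding v repairs it at the
-- cost of one vertex.  For the weight, v goes from degree d ∈ {1, 2} to d + 1,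
-- losing 1, while the attached K₂,₃ has degrees 3, 3, 3, 2, 2 and weight 17.

module Submission where

open import Defs
open import Data.Nat.Properties using (+-0-commutativeMonoid; +-assoc; +-suc; +-identityʳ; ≤-refl; ≤-trans; n≤1+n; +-mono-≤; +-monoˡ-≤; +-monoʳ-≤; module ≤-Reasoning)
open import Algebra.Properties.CommutativeMonoid.Sum +-0-commutativeMonoid
  using (∑-distrib-+; sum-cong-≗; sum-replicate-zero) renaming (sum to ∑)
open import Data.Bool using (true; false; _∧_)
open import Data.Bool.Properties using (∧-zeroʳ; ∧-comm; ¬-not; T-≡; T-∧) renaming (_≟_ to _≟ᵇ_)
open import Data.Empty using (⊥-elim)
open import Data.Fin using (Fin; zero; suc; splitAt; _↑ˡ_; _↑ʳ_)
open import Data.Fin.Properties using (_≟_; all?; any?; splitAt-↑ˡ; splitAt-↑ʳ; join-splitAt)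
open import Data.Fin.Subset using (Subset; inside; outside; _∈_; _∉_; ∣_∣; _∪_; ⁅_⁆)
open import Data.Fin.Subset.Properties using (_∈?_; x∈p∪q⁻; x∈p∪q⁺; x∈⁅x⁆; x∈⁅y⁆⇒x≡y; ∪-identityʳ)
open import Data.List using (tabulate; map; allFin)
open import Data.List.Properties using (map-tabulate)
open import Data.Nat using (ℕ; zero; suc; _+_; _≤_; _≤?_; s≤s)
open import Data.Nat.ListAction using (sum)
open import Data.Product using (∃; _×_; _,_; proj₁; proj₂)
open import Data.Sum using (inj₁; inj₂)
open import Data.Vec using (Vec; []; _∷_; _++_; here; there)
import Data.Vec as Vec
open import Function using (_∘_; Equivalence)
open import Relation.Nullary using (¬_; Dec; yes; no; map′; ¬?; _×-dec_; _→-dec_)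
open import Relation.Nullary.Decidable using (⌊_⌋; from-yes; toWitness)
open import Relation.Binary.PropositionalEquality using (_≡_; _≢_; refl; sym; trans; cong; cong₂; subst; module ≡-Reasoning)

sum-tabulate : ∀ {m} (f : Fin m → ℕ) → sum (tabulate f) ≡ ∑ f
sum-tabulate {zero}  f = refl
sum-tabulate {suc m} f = cong (f zero +_) (sum-tabulate (f ∘ suc))

sum-map-allFin : ∀ {m} (f : Fin m → ℕ) → sum (map f (allFin m)) ≡ ∑ f
sum-map-allFin f = trans (cong sum (map-tabulate (λ i → i) f)) (sum-tabulate f)

∑-↑ : ∀ m {k} (f : Fin (m + k) → ℕ) → ∑ f ≡ ∑ (f ∘ (_↑ˡ k)) + ∑ (f ∘ (m ↑ʳ_))
∑-↑ zero    f = refl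
∑-↑ (suc m) f = trans (cong (f zero +_) (∑-↑ m (f ∘ suc))) (sym (+-assoc (f zero) _ _))

⌊suc≟suc⌋ : ∀ {m} (x y : Fin m) → ⌊ suc x ≟ suc y ⌋ ≡ ⌊ x ≟ y ⌋
⌊suc≟suc⌋ x y with x ≟ y
... | yes _ = refl
... | no  _ = refl

∑-indicator : ∀ {m} c (x : Fin m) → ∑ (λ y → b2n (c ∧ ⌊ y ≟ x ⌋)) ≡ b2n c
∑-indicator {suc m} false x       = sum-replicate-zero (suc m)
∑-indicator {suc m} true  zero    = cong suc (sum-replicate-zero m)
∑-indicator {suc m} true  (suc x) = trans (sum-cong-≗ (λ y → cong b2n (⌊suc≟suc⌋ y x))) (∑-indicator true x)

deg-∑ : ∀ {m} (A : Adj m) x → deg A x ≡ ∑ (b2n ∘ A x)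
deg-∑ A x = sum-map-allFin (b2n ∘ A x)

weight-∑ : ∀ {m} (A : Adj m) → weight A ≡ ∑ (wdeg ∘ deg A)
weight-∑ A = sum-map-allFin (wdeg ∘ deg A)

deg-++ : ∀ m {k} (A : Adj (m + k)) x →
  deg A x ≡ ∑ (b2n ∘ A x ∘ (_↑ˡ k)) + ∑ (b2n ∘ A x ∘ (m ↑ʳ_))
deg-++ m A x = trans (deg-∑ A x) (∑-↑ m (b2n ∘ A x))

wdeg-suc : ∀ {d} → 1 ≤ d → d ≤ 2 → wdeg (d + 1) + 1 ≡ wdeg d
wdeg-suc {1}                 _ _ = refl
wdeg-suc {2}                 _ _ = refl
wdeg-suc {suc (suc (suc _))} _ (s≤s (s≤s ()))

∈-++⁺ˡ : ∀ {m k} {S : Subset m} {T : Subset k} {u} → u ∈ S → u ↑ˡ k ∈ S ++ T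
∈-++⁺ˡ here      = here
∈-++⁺ˡ (there u∈) = there (∈-++⁺ˡ u∈)

∈-++⁻ˡ : ∀ {m k} (S : Subset m) {T : Subset k} {u} → u ↑ˡ k ∈ S ++ T → u ∈ S
∈-++⁻ˡ (_ ∷ _) {u = zero}  here       = here
∈-++⁻ˡ (_ ∷ S) {u = suc _} (there u∈) = there (∈-++⁻ˡ S u∈)

∈-++⁺ʳ : ∀ {m k} (S : Subset m) {T : Subset k} {p} → p ∈ T → m ↑ʳ p ∈ S ++ T
∈-++⁺ʳ []      p∈ = p∈
∈-++⁺ʳ (_ ∷ S) p∈ = there (∈-++⁺ʳ S p∈)

∈-++⁻ʳ : ∀ {m k} (S : Subset m) {T : Subset k} {p} → m ↑ʳ p ∈ S ++ T → p ∈ T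
∈-++⁻ʳ []      p∈         = p∈
∈-++⁻ʳ (_ ∷ S) (there p∈) = ∈-++⁻ʳ S p∈

∣p++q∣ : ∀ {m k} (p : Subset m) (q : Subset k) → ∣ p ++ q ∣ ≡ ∣ p ∣ + ∣ q ∣
∣p++q∣ []            q = refl
∣p++q∣ (inside  ∷ p) q = cong suc (∣p++q∣ p q)
∣p++q∣ (outside ∷ p) q = ∣p++q∣ p q

∣p∪⁅x⁆∣≤1+∣p∣ : ∀ {n} (p : Subset n) x → ∣ p ∪ ⁅ x ⁆ ∣ ≤ suc ∣ p ∣
∣p∪⁅x⁆∣≤1+∣p∣ (inside  ∷ p) zero    rewrite ∪-identityʳ p = s≤s (n≤1+n _)
∣p∪⁅x⁆∣≤1+∣p∣ (outside ∷ p) zero    rewrite ∪-identityʳ p = ≤-refl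
∣p∪⁅x⁆∣≤1+∣p∣ (inside  ∷ p) (suc x) = s≤s (∣p∪⁅x⁆∣≤1+∣p∣ p x)
∣p∪⁅x⁆∣≤1+∣p∣ (outside ∷ p) (suc x) = ∣p∪⁅x⁆∣≤1+∣p∣ p x

allSubset? : ∀ {n} {P : Subset n → Set} → (∀ S → Dec (P S)) → Dec (∀ S → P S)
allSubset? {zero}  P? = map′ (λ { p [] → p }) (λ p → p []) (P? [])
allSubset? {suc n} P? = map′
  (λ { (p , q) (inside ∷ S) → p S ; (p , q) (outside ∷ S) → q S })
  (λ p → p ∘ (inside ∷_) , p ∘ (outside ∷_))
  (allSubset? (P? ∘ (inside ∷_)) ×-dec allSubset? (P? ∘ (outside ∷_)))

data Side (m k : ℕ) : Fin (m + k) → Set where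
  left  : (u : Fin m) → Side m k (u ↑ˡ k)
  right : (p : Fin k) → Side m k (m ↑ʳ p)

side : ∀ m k x → Side m k x
side m k x with splitAt m x | join-splitAt m k x
... | inj₁ u | u↑ˡk≡x = subst (Side m k) u↑ˡk≡x (left u)
... | inj₂ p | m↑ʳp≡x = subst (Side m k) m↑ʳp≡x (right p)

Dominates : ∀ {n} → Adj n → Subset n → Fin n → Set
Dominates A S x = x ∉ S → ∃ λ y → y ∈ S × A x y ≡ true

independent? : ∀ {n} (A : Adj n) S → Dec (Independent A S)
independent? A S = all? λ x → all? λ y →
  (x ∈? S) →-dec ((y ∈? S) →-dec (A x y ≟ᵇ false))

dominates? : ∀ {n} (A : Adj n) S x → Dec (Dominates A S x)
dominates? A S x = ¬? (x ∈? S) →-dec any? λ y → (y ∈? S) ×-dec (A x y ≟ᵇ true)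

dominating? : ∀ {n} (A : Adj n) S → Dec (Dominating A S)
dominating? A S = all? (dominates? A S)

-- If v is not dominated then it has no neighbour in S, so S ∪ {v} stays independent.
dominating-but-one⇒ : ∀ {n} {A : Adj n} {S v} → IsSimple A → Independent A S →
  (∀ u → u ≢ v → Dominates A S u) →
  ∃ λ S* → IndependentDominating A S* × ∣ S* ∣ ≤ suc ∣ S ∣
dominating-but-one⇒ {A = A} {S} {v} (symmetric , irreflexive) ind dom with dominates? A S v
... | yes dom-v = S , (ind , dominating) , n≤1+n ∣ S ∣
  where
  dominating : Dominating A S
  dominating u with u ≟ v
  ... | yes refl = dom-v
  ... | no  u≢v  = dom u u≢v
... | no ¬dom-v = S ∪ ⁅ v ⁆ , (ind* , dom*) , ∣p∪⁅x⁆∣≤1+∣p∣ S v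
  where
  v-isolated : ∀ w → w ∈ S → A v w ≡ false
  v-isolated w w∈S = ¬-not λ e → ¬dom-v λ _ → w , w∈S , e
  edge-to-v : ∀ w → w ∈ S ∪ ⁅ v ⁆ → A v w ≡ false
  edge-to-v w w∈ with x∈p∪q⁻ S ⁅ v ⁆ w∈
  ... | inj₁ w∈S = v-isolated w w∈S
  ... | inj₂ w∈v rewrite x∈⁅y⁆⇒x≡y v w∈v = irreflexive v
  ind* : Independent A (S ∪ ⁅ v ⁆)
  ind* x y x∈ y∈ with x∈p∪q⁻ S ⁅ v ⁆ x∈ | x∈p∪q⁻ S ⁅ v ⁆ y∈
  ... | inj₁ x∈S | inj₁ y∈S = ind x y x∈S y∈S
  ... | inj₂ x∈v | _        rewrite x∈⁅y⁆⇒x≡y v x∈v = edge-to-v y y∈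
  ... | inj₁ _   | inj₂ y∈v rewrite x∈⁅y⁆⇒x≡y v y∈v = trans (symmetric x v) (edge-to-v x x∈)
  dom* : Dominating A (S ∪ ⁅ v ⁆)
  dom* u u∉ with u ≟ v
  ... | yes refl = ⊥-elim (u∉ (x∈p∪q⁺ (inj₂ (x∈⁅x⁆ u))))
  ... | no  u≢v with dom u u≢v (λ u∈S → u∉ (x∈p∪q⁺ (inj₁ u∈S)))
  ...   | w , w∈S , e = w , x∈p∪q⁺ (inj₁ w∈S) , e

minimum-but-one : ∀ {n} {A : Adj n} {k S v} → IsSimple A →
  (∀ S → IndependentDominating A S → k ≤ ∣ S ∣) → Independent A S →
  (∀ u → u ≢ v → Dominates A S u) → k ≤ suc ∣ S ∣
minimum-but-one simple minimal ind dom with dominating-but-one⇒ simple ind dom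
... | S* , ids , size = ≤-trans (minimal S* ids) size

K23-small : Subset 5
K23-small = inside ∷ inside ∷ outside ∷ outside ∷ outside ∷ []

K23-small-ids : IndependentDominating K23 K23-small
K23-small-ids = from-yes (independent? K23 K23-small ×-dec dominating? K23 K23-small)

2↑ʳj∉K23-small : ∀ (j : Fin 3) → 2 ↑ʳ j ∉ K23-small
2↑ʳj∉K23-small = from-yes (all? λ j → ¬? (2 ↑ʳ j ∈? K23-small))

K23-bound : ∀ (j : Fin 3) T → Independent K23 T → (∀ p → p ≢ 2 ↑ʳ j → Dominates K23 T p) →
  2 ≤ ∣ T ∣ × (2 ↑ʳ j ∈ T → 3 ≤ ∣ T ∣)
K23-bound = from-yes (all? λ j → allSubset? λ T →
  independent? K23 T →-dec
  ((all? λ p → ¬? (p ≟ 2 ↑ʳ j) →-dec dominates? K23 T p) →-dec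
  ((2 ≤? ∣ T ∣) ×-dec ((2 ↑ʳ j ∈? T) →-dec (3 ≤? ∣ T ∣)))))

K23-attached-weight : ∀ (j : Fin 3) → ∑ (λ p → wdeg (b2n ⌊ p ≟ 2 ↑ʳ j ⌋ + deg K23 p)) ≡ 17
K23-attached-weight zero             = refl
K23-attached-weight (suc zero)       = refl
K23-attached-weight (suc (suc zero)) = refl

module Attached {n} (A : Adj n) (v : Fin n) (j : Fin 3) where

  G : Adj (n + 5)
  G = attachK23 A v j

  x₀ : Fin 5
  x₀ = 2 ↑ʳ j

  G-ˡˡ : ∀ u w → G (u ↑ˡ 5) (w ↑ˡ 5) ≡ A u w
  G-ˡˡ u w rewrite splitAt-↑ˡ n u 5 | splitAt-↑ˡ n w 5 = refl

  G-ʳʳ : ∀ p q → G (n ↑ʳ p) (n ↑ʳ q) ≡ K23 p q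
  G-ʳʳ p q rewrite splitAt-↑ʳ n 5 p | splitAt-↑ʳ n 5 q = refl

  G-ˡʳ : ∀ u p → G (u ↑ˡ 5) (n ↑ʳ p) ≡ ⌊ u ≟ v ⌋ ∧ ⌊ p ≟ x₀ ⌋
  G-ˡʳ u p rewrite splitAt-↑ˡ n u 5 | splitAt-↑ʳ n 5 p = refl

  G-ʳˡ : ∀ p u → G (n ↑ʳ p) (u ↑ˡ 5) ≡ ⌊ u ≟ v ⌋ ∧ ⌊ p ≟ x₀ ⌋
  G-ʳˡ p u rewrite splitAt-↑ˡ n u 5 | splitAt-↑ʳ n 5 p = refl

  bridge⇒ : ∀ {u p} → ⌊ u ≟ v ⌋ ∧ ⌊ p ≟ x₀ ⌋ ≡ true → u ≡ v × p ≡ x₀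
  bridge⇒ {u} {p} e with Equivalence.to (T-∧ {⌊ u ≟ v ⌋}) (Equivalence.from T-≡ e)
  ... | u≟v , p≟x₀ = toWitness u≟v , toWitness p≟x₀

  bridge-absent : ∀ u {p} → p ≢ x₀ → ⌊ u ≟ v ⌋ ∧ ⌊ p ≟ x₀ ⌋ ≡ false
  bridge-absent u {p} p≢x₀ with p ≟ x₀
  ... | yes p≡x₀ = ⊥-elim (p≢x₀ p≡x₀)
  ... | no  _    = ∧-zeroʳ ⌊ u ≟ v ⌋

  deg-↑ˡ : ∀ u → deg G (u ↑ˡ 5) ≡ deg A u + b2n ⌊ u ≟ v ⌋
  deg-↑ˡ u = begin
    deg G (u ↑ˡ 5)
      ≡⟨ deg-++ n G (u ↑ˡ 5) ⟩
    ∑ (b2n ∘ G (u ↑ˡ 5) ∘ (_↑ˡ 5)) + ∑ (b2n ∘ G (u ↑ˡ 5) ∘ (n ↑ʳ_))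
      ≡⟨ cong₂ _+_ (sum-cong-≗ (cong b2n ∘ G-ˡˡ u)) (sum-cong-≗ (cong b2n ∘ G-ˡʳ u)) ⟩
    ∑ (b2n ∘ A u) + ∑ (λ p → b2n (⌊ u ≟ v ⌋ ∧ ⌊ p ≟ x₀ ⌋))
      ≡⟨ cong₂ _+_ (sym (deg-∑ A u)) (∑-indicator ⌊ u ≟ v ⌋ x₀) ⟩
    deg A u + b2n ⌊ u ≟ v ⌋ ∎
    where open ≡-Reasoning

  deg-↑ʳ : ∀ p → deg G (n ↑ʳ p) ≡ b2n ⌊ p ≟ x₀ ⌋ + deg K23 p
  deg-↑ʳ p = begin
    deg G (n ↑ʳ p)
      ≡⟨ deg-++ n G (n ↑ʳ p) ⟩
    ∑ (b2n ∘ G (n ↑ʳ p) ∘ (_↑ˡ 5)) + ∑ (b2n ∘ G (n ↑ʳ p) ∘ (n ↑ʳ_))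
      ≡⟨ cong₂ _+_ (sum-cong-≗ λ u → cong b2n (trans (G-ʳˡ p u) (∧-comm ⌊ u ≟ v ⌋ _)))
                   (sum-cong-≗ (cong b2n ∘ G-ʳʳ p)) ⟩
    ∑ (λ u → b2n (⌊ p ≟ x₀ ⌋ ∧ ⌊ u ≟ v ⌋)) + ∑ (b2n ∘ K23 p)
      ≡⟨ cong₂ _+_ (∑-indicator ⌊ p ≟ x₀ ⌋ v) (sym (deg-∑ K23 p)) ⟩
    b2n ⌊ p ≟ x₀ ⌋ + deg K23 p ∎
    where open ≡-Reasoning

  weight-attach : 1 ≤ deg A v → deg A v ≤ 2 → weight G ≡ weight A + 16
  weight-attach 1≤deg deg≤2 = begin
    weight G
      ≡⟨ trans (weight-∑ G) (∑-↑ n (wdeg ∘ deg G)) ⟩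
    ∑ (wdeg ∘ deg G ∘ (_↑ˡ 5)) + ∑ (wdeg ∘ deg G ∘ (n ↑ʳ_))
      ≡⟨ cong₂ _+_ (sum-cong-≗ (cong wdeg ∘ deg-↑ˡ))
                   (trans (sum-cong-≗ (cong wdeg ∘ deg-↑ʳ)) (K23-attached-weight j)) ⟩
    ∑ wdeg′ + 17
      ≡⟨ sym (+-assoc (∑ wdeg′) 1 16) ⟩
    ∑ wdeg′ + 1 + 16
      ≡⟨ cong (λ s → ∑ wdeg′ + s + 16) (sym (∑-indicator true v)) ⟩
    ∑ wdeg′ + ∑ δ + 16
      ≡⟨ cong (_+ 16) (sym (∑-distrib-+ wdeg′ δ)) ⟩
    ∑ (λ u → wdeg′ u + δ u) + 16
      ≡⟨ cong (_+ 16) (trans (sum-cong-≗ wdeg′+δ) (sym (weight-∑ A))) ⟩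
    weight A + 16 ∎
    where
    open ≡-Reasoning
    δ wdeg′ : Fin n → ℕ
    δ u = b2n ⌊ u ≟ v ⌋
    wdeg′ u = wdeg (deg A u + δ u)
    wdeg′+δ : ∀ u → wdeg′ u + δ u ≡ wdeg (deg A u)
    wdeg′+δ u with u ≟ v
    ... | yes refl = wdeg-suc 1≤deg deg≤2
    ... | no  _    = trans (+-identityʳ _) (cong wdeg (+-identityʳ _))

  ++-independent : ∀ {S T} → Independent A S → Independent K23 T → x₀ ∉ T →
    Independent G (S ++ T)
  ++-independent {S} {T} indA indK x₀∉T x y x∈ y∈ with side n 5 x | side n 5 y
  ... | left u  | left w  = trans (G-ˡˡ u w) (indA u w (∈-++⁻ˡ S x∈) (∈-++⁻ˡ S y∈))
  ... | left u  | right p = trans (G-ˡʳ u p) (bridge-absent u λ { refl → x₀∉T (∈-++⁻ʳ S y∈) })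
  ... | right p | left u  = trans (G-ʳˡ p u) (bridge-absent u λ { refl → x₀∉T (∈-++⁻ʳ S x∈) })
  ... | right p | right q = trans (G-ʳʳ p q) (indK p q (∈-++⁻ʳ S x∈) (∈-++⁻ʳ S y∈))

  ++-dominating : ∀ {S T} → Dominating A S → Dominating K23 T → Dominating G (S ++ T)
  ++-dominating {S} {T} domA domK x x∉ with side n 5 x
  ... | left u with domA u (x∉ ∘ ∈-++⁺ˡ)
  ...   | w , w∈ , e = w ↑ˡ 5 , ∈-++⁺ˡ w∈ , trans (G-ˡˡ u w) e
  ++-dominating {S} {T} domA domK x x∉ | right p with domK p (x∉ ∘ ∈-++⁺ʳ S)
  ...   | q , q∈ , e = n ↑ʳ q , ∈-++⁺ʳ S q∈ , trans (G-ʳʳ p q) e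

  ++-independentˡ : ∀ S {T} → Independent G (S ++ T) → Independent A S
  ++-independentˡ S ind u w u∈ w∈ =
    trans (sym (G-ˡˡ u w)) (ind (u ↑ˡ 5) (w ↑ˡ 5) (∈-++⁺ˡ u∈) (∈-++⁺ˡ w∈))

  ++-independentʳ : ∀ S {T} → Independent G (S ++ T) → Independent K23 T
  ++-independentʳ S ind p q p∈ q∈ =
    trans (sym (G-ʳʳ p q)) (ind (n ↑ʳ p) (n ↑ʳ q) (∈-++⁺ʳ S p∈) (∈-++⁺ʳ S q∈))

  ++-dominatesˡ : ∀ S {T} → Dominating G (S ++ T) → ∀ u → ¬ (u ≡ v × x₀ ∈ T) →
    Dominates A S u
  ++-dominatesˡ S dom u ¬attached u∉ with dom (u ↑ˡ 5) (u∉ ∘ ∈-++⁻ˡ S)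
  ... | y , y∈ , e with side n 5 y
  ...   | left w  = w , ∈-++⁻ˡ S y∈ , trans (sym (G-ˡˡ u w)) e
  ...   | right q with bridge⇒ {u} {q} (trans (sym (G-ˡʳ u q)) e)
  ...     | u≡v , refl = ⊥-elim (¬attached (u≡v , ∈-++⁻ʳ S y∈))

  ++-dominatesʳ : ∀ S {T} → Dominating G (S ++ T) → ∀ p → p ≢ x₀ → Dominates K23 T p
  ++-dominatesʳ S dom p p≢x₀ p∉ with dom (n ↑ʳ p) (p∉ ∘ ∈-++⁻ʳ S)
  ... | y , y∈ , e with side n 5 y
  ...   | left u  = ⊥-elim (p≢x₀ (proj₂ (bridge⇒ {u} {p} (trans (sym (G-ʳˡ p u)) e))))
  ...   | right q = q , ∈-++⁻ʳ S y∈ , trans (sym (G-ʳʳ p q)) e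

  ++-K23-small : ∀ {S} → IndependentDominating A S → IndependentDominating G (S ++ K23-small)
  ++-K23-small (ind , dom) =
    ++-independent ind (proj₁ K23-small-ids) (2↑ʳj∉K23-small j) , ++-dominating dom (proj₂ K23-small-ids)

  ++-lower-bound : IsSimple A → ∀ {k} → (∀ S → IndependentDominating A S → k ≤ ∣ S ∣) →
    ∀ S T → IndependentDominating G (S ++ T) → k + 2 ≤ ∣ S ∣ + ∣ T ∣
  ++-lower-bound simple {k} minimal S T (ind , dom) = by-cases (x₀ ∈? T)
    where
    open ≤-Reasoning
    indA : Independent A S
    indA = ++-independentˡ S ind
    domA : ∀ u → ¬ (u ≡ v × x₀ ∈ T) → Dominates A S u
    domA = ++-dominatesˡ S dom
    bound : 2 ≤ ∣ T ∣ × (x₀ ∈ T → 3 ≤ ∣ T ∣)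
    bound = K23-bound j T (++-independentʳ S ind) (++-dominatesʳ S dom)
    by-cases : Dec (x₀ ∈ T) → k + 2 ≤ ∣ S ∣ + ∣ T ∣
    by-cases (no x₀∉T) = +-mono-≤ (minimal S (indA , λ u → domA u (x₀∉T ∘ proj₂))) (proj₁ bound)
    by-cases (yes x₀∈T) = begin
      k + 2          ≤⟨ +-monoˡ-≤ 2 (minimum-but-one simple minimal indA λ u u≢v → domA u (u≢v ∘ proj₁)) ⟩
      suc ∣ S ∣ + 2  ≡⟨ sym (+-suc ∣ S ∣ 2) ⟩
      ∣ S ∣ + 3      ≤⟨ +-monoʳ-≤ ∣ S ∣ (proj₂ bound x₀∈T) ⟩
      ∣ S ∣ + ∣ T ∣  ∎

lemma1 : (n : ℕ) (A : Adj n) → IsSimple A → Subcubic A → NoIsolated A →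
         (v : Fin n) → deg A v ≤ 2 → (j : Fin 3) →
         (∀ k → IsIndDomNum A k → IsIndDomNum (attachK23 A v j) (k + 2))
         × (weight (attachK23 A v j) ≡ weight A + 16)
lemma1 n A simple _ noIsolated v deg-v≤2 j =
  (λ k (attained , minimal) → upper attained , lower minimal) , weight-attach (noIsolated v) deg-v≤2
  where
  open Attached A v j
  upper : ∀ {k} → ∃ (λ S → IndependentDominating A S × ∣ S ∣ ≡ k) →
          ∃ λ S → IndependentDominating G S × ∣ S ∣ ≡ k + 2
  upper (S , ids , refl) = S ++ K23-small , ++-K23-small ids , ∣p++q∣ S K23-small
  lower : ∀ {k} → (∀ S → IndependentDominating A S → k ≤ ∣ S ∣) →
          ∀ S → IndependentDominating G S → k + 2 ≤ ∣ S ∣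
  lower minimal S ids with Vec.splitAt n S
  ... | S₁ , S₂ , refl = subst (_ ≤_) (sym (∣p++q∣ S₁ S₂)) (++-lower-bound simple minimal S₁ S₂ ids)
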